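{- Let $\pi$ be a permutation of $[n]$ and let $\tau$ be a type schedule (a sequence of pile types in $\{\mathrm{Q},\mathrm{S}\}$ indexed by piles $1,2,\dots$, possibly finite). If there exists a pile assignment function $\rho$ (with values among the piles of $\tau$) such that $(\tau,\rho)$ sorts $\pi$, then the function $\rho^*$ given by $$\rho^*(1)=1,\qquad \rho^*(s+1)=\rho^*(s)+\big[\pi(s+1)\prec_{\tau(\rho^*(s))}\pi(s)\big]\quad(s\in[n-1])$$ is well defined (all its values are piles of $\tau$), $(\tau,\rho^*)$ sorts $\pi$, and $\rho^*$ is a minimal sort of $\pi$ on $\tau$: $\rho^*(n)\le\rho(n)$ for every $\rho$ with $\rho(1)=1$ such that $(\tau,\rho)$ sorts $\pi$. Here $i\prec_{\mathrm{Q}} j\iff i<j$ and $i\prec_{\mathrm{S}} j\iff i>j$.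
   Context: A deck of cards labelled by $[n]$ is represented by a permutation $\pi$ of $[n]$ with $\pi(s)$ the position (from the top) of label $s$. Label $s$ is dealt to the $\rho(s)$-th pile collected; pile $p$ has type $\tau(p)\in\{\mathrm{Q},\mathrm{S}\}$ (queue preserves placement order, stack reverses it). With $\chi(p)=[\tau(p)=\mathrm{S}]$, the heterogeneous shuffle of $\pi$ with $(\tau,\rho)$ is the unique permutation $\sigma$ of $[n]$ with $\sigma(s)<\sigma(t)$ iff $\big(\rho(s),(-1)^{\chi(\rho(s))}\pi(s)\big)<\big(\rho(t),(-1)^{\chi(\rho(t))}\pi(t)\big)$ lexicographically; $(\tau,\rho)$ sorts $\pi$ if $\sigma$ is the identity. $[P]$ is the indicator of $P$. -}

module Defs where

open import Data.Nat using (ℕ; zero; suc; _+_; _≤_; _<_; _<?_; _<ᵇ_)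
open import Data.Bool using (Bool; true; false)
open import Data.Fin using (Fin; toℕ; fromℕ<)
open import Data.Fin.Permutation using (Permutation′; _⟨$⟩ʳ_)
open import Data.Integer as ℤ using (ℤ; +_; -_)
open import Data.Maybe using (Maybe; just; nothing)
open import Data.Product using (_×_)
open import Data.Sum using (_⊎_)
open import Relation.Binary.PropositionalEquality using (_≡_)
open import Relation.Nullary using (yes; no)
open import Function.Bundles using (_⇔_)

data PileType : Set where
  Q S : PileType

-- A type schedule: piles are numbered 1,2,...; `type p` is the type of
-- pile p (the value at p = 0 is irrelevant); `len` is `just L` if the
-- schedule is finite with piles 1..L, and `nothing` if it is infinite.
record TypeSchedule : Set where
  field
    type : ℕ → PileType
    len  : Maybe ℕ
open TypeSchedule public

IsPile : TypeSchedule → ℕ → Set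
IsPile τ p = (1 ≤ p) × (∀ L → len τ ≡ just L → p ≤ L)

-- Position (from the top, 1-based) of label s; labels 1..n are Fin n
-- (label s+1 is represented by the Fin element with toℕ = s).
pos : ∀ {n} → Permutation′ n → Fin n → ℕ
pos π s = suc (toℕ (π ⟨$⟩ʳ s))

signed : PileType → ℕ → ℤ
signed Q i = + i
signed S i = - (+ i)

_<lex_ : ℕ × ℤ → ℕ × ℤ → Set
(a₁ Data.Product., a₂) <lex (b₁ Data.Product., b₂) = (a₁ < b₁) ⊎ ((a₁ ≡ b₁) × (a₂ ℤ.< b₂))

key : ∀ {n} → TypeSchedule → (Fin n → ℕ) → Permutation′ n → Fin n → ℕ × ℤ
key τ ρ π s = ρ s Data.Product., signed (type τ (ρ s)) (pos π s)

-- (τ,ρ) sorts π: the heterogeneous shuffle σ is the identity, i.e. the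
-- identity permutation is the (unique) σ with
--   σ(s) < σ(t)  iff  key(s) <lex key(t).
Sorts : ∀ {n} → TypeSchedule → (Fin n → ℕ) → Permutation′ n → Set
Sorts τ ρ π = ∀ s t → (toℕ s < toℕ t) ⇔ (key τ ρ π s <lex key τ ρ π t)

prec : PileType → ℕ → ℕ → Bool
prec Q i j = i <ᵇ j
prec S i j = j <ᵇ i

iverson : Bool → ℕ
iverson true  = 1
iverson false = 0

-- Position of the label with 0-based index k (junk value 0 if k ≥ n).
posℕ : ∀ {n} → Permutation′ n → ℕ → ℕ
posℕ {n} π k with k <? n
... | yes k<n = pos π (fromℕ< k<n)
... | no _    = 0

-- ρ* on 0-based label indices:  ρ*(1) = 1,
-- ρ*(s+1) = ρ*(s) + [π(s+1) ≺_{τ(ρ*(s))} π(s)].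
rstarℕ : ∀ {n} → TypeSchedule → Permutation′ n → ℕ → ℕ
rstarℕ τ π zero    = 1
rstarℕ τ π (suc k) =
  rstarℕ τ π k + iverson (prec (type τ (rstarℕ τ π k)) (posℕ π (suc k)) (posℕ π k))

rstar : ∀ {n} → TypeSchedule → Permutation′ n → Fin n → ℕ
rstar τ π s = rstarℕ τ π (toℕ s)

{-# OPTIONS --safe #-}
-- Reading the labels in order, (τ,ρ) sorts π exactly when the keys of consecutive
-- labels increase.  ρ* keeps the next label on the current pile whenever that
-- pile's order allows it, and otherwise opens the following pile; so consecutive
-- ρ*-keys increase and ρ* sorts π.  If ρ* opens a new pile after
-- label s, then any sort that still has s on pile ρ*(s) cannot put s+1 on the same
-- pile, so ρ*(s) ≤ ρ(s) propagates along the labels.  In particular ρ* stays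
-- below any sort, hence uses only piles of τ.
module Submission where

open import Defs
open import Data.Nat using (ℕ; suc; _≤_)
open import Data.Fin using (Fin; zero; fromℕ)
open import Data.Fin.Permutation using (Permutation′)
open import Data.Product using (_×_; ∃)
open import Relation.Binary.PropositionalEquality using (_≡_)

open import Data.Bool using (true; false; T)
open import Data.Unit using (tt)
open import Data.Fin as F using (toℕ; inject₁)
open import Data.Fin.Induction using (<-weakInduction)
import Data.Fin.Properties as FP
open import Data.Integer as ℤ using (ℤ; +<+)
import Data.Integer.Properties as ℤP
open import Data.Nat as ℕ using (_+_; _<_)
import Data.Nat.Properties as ℕP
open import Data.Product using (_,_; proj₁; proj₂)
open import Data.Product.Relation.Binary.Lex.Strict using (×-transitive; ×-asymmetric)
open import Data.Sum using (inj₁; inj₂)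
open import Function using (_∘_; _⇔_; mk⇔; Equivalence; Injection)
open import Function.Properties.Inverse using (↔⇒↣)
open import Level using (Level)
open import Relation.Binary using (Rel; Transitive; Asymmetric; tri<; tri≈; tri>)
open import Relation.Binary.PropositionalEquality
  using (_≢_; refl; sym; trans; cong; cong₂; subst; isEquivalence; resp₂; module ≡-Reasoning)
open import Relation.Nullary using (¬_; yes; no; contradiction)

open Equivalence using (to; from)

inject₁<suc : ∀ {m} (i : Fin m) → inject₁ i F.< F.suc i
inject₁<suc i = FP.≤̄⇒inject₁< ℕP.≤-refl

module _ {a ℓ : Level} {A : Set a} {_≺_ : Rel A ℓ}
         (≺-trans : Transitive _≺_) (≺-asym : Asymmetric _≺_)
         {m : ℕ} (f : Fin (suc m) → A) where

  successorSteps⇒strictlyIncreasing :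
    (∀ i → f (inject₁ i) ≺ f (F.suc i)) → ∀ {s t} → s F.< t → f s ≺ f t
  successorSteps⇒strictlyIncreasing step {s} =
    <-weakInduction (λ t → s F.< t → f s ≺ f t) (λ ()) extend _
    where
    extend : ∀ j → (s F.< inject₁ j → f s ≺ f (inject₁ j)) →
             s F.< F.suc j → f s ≺ f (F.suc j)
    extend j ih s<1+j with FP.<-cmp s (inject₁ j)
    ... | tri< s<j _ _  = ≺-trans (ih s<j) (step j)
    ... | tri≈ _ refl _ = step j
    ... | tri> _ _ j<s  =
      contradiction (ℕ.s≤s⁻¹ s<1+j) (ℕP.<⇒≱ (subst (_< toℕ s) (FP.toℕ-inject₁ j) j<s))

  strictlyIncreasing⇒reflects :
    (∀ {s t} → s F.< t → f s ≺ f t) → ∀ {s t} → f s ≺ f t → s F.< t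
  strictlyIncreasing⇒reflects increasing {s} {t} fs≺ft with FP.<-cmp s t
  ... | tri< s<t _ _  = s<t
  ... | tri≈ _ refl _ = contradiction fs≺ft (≺-asym fs≺ft)
  ... | tri> _ _ t<s  = contradiction (increasing t<s) (≺-asym fs≺ft)

  orderEmbedding⇔successorSteps :
    (∀ s t → s F.< t ⇔ f s ≺ f t) ⇔ (∀ i → f (inject₁ i) ≺ f (F.suc i))
  orderEmbedding⇔successorSteps = mk⇔
    (λ embedding i → to (embedding (inject₁ i) (F.suc i)) (inject₁<suc i))
    (λ step s t → mk⇔ (increasing step) (strictlyIncreasing⇒reflects (increasing step)))
    where increasing = successorSteps⇒strictlyIncreasing

<lex-trans : Transitive _<lex_
<lex-trans = ×-transitive {_≈₁_ = _≡_} {_<₁_ = ℕ._<_} {_<₂_ = ℤ._<_}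
  isEquivalence (resp₂ ℕ._<_) ℕP.<-trans ℤP.<-trans

<lex-asym : Asymmetric _<lex_
<lex-asym = ×-asymmetric {_≈₁_ = _≡_} {_<₁_ = ℕ._<_} {_<₂_ = ℤ._<_}
  sym (resp₂ ℕ._<_) ℕP.<-asym ℤP.<-asym

<lex⇒proj₁-≤ : ∀ {x y} → x <lex y → proj₁ x ≤ proj₁ y
<lex⇒proj₁-≤ (inj₁ x₁<y₁)      = ℕP.<⇒≤ x₁<y₁
<lex⇒proj₁-≤ (inj₂ (refl , _)) = ℕP.≤-refl

Sorts⇔keySteps : ∀ {m} (τ : TypeSchedule) (ρ : Fin (suc m) → ℕ) (π : Permutation′ (suc m)) →
  Sorts τ ρ π ⇔ (∀ i → key τ ρ π (inject₁ i) <lex key τ ρ π (F.suc i))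
Sorts⇔keySteps τ ρ π = orderEmbedding⇔successorSteps {_≺_ = _<lex_} <lex-trans <lex-asym (key τ ρ π)

prec⇔signed-< : ∀ ty {i j} → T (prec ty i j) ⇔ signed ty i ℤ.< signed ty j
prec⇔signed-< Q = mk⇔ (+<+ ∘ ℕP.<ᵇ⇒< _ _) (ℕP.<⇒<ᵇ ∘ ℤP.drop‿+<+)
prec⇔signed-< S = mk⇔ (ℤP.neg-mono-< ∘ +<+ ∘ ℕP.<ᵇ⇒< _ _) (ℕP.<⇒<ᵇ ∘ ℤP.drop‿+<+ ∘ ℤP.neg-cancel-<)

signed-injective : ∀ ty {i j} → signed ty i ≡ signed ty j → i ≡ j
signed-injective Q = ℤP.+-injective
signed-injective S = ℤP.+-injective ∘ ℤP.neg-injective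

iverson-true : ∀ {b} → T b → iverson b ≡ 1
iverson-true {true} _ = refl

iverson-false : ∀ {b} → ¬ T b → iverson b ≡ 0
iverson-false {false} _  = refl
iverson-false {true}  ¬t = contradiction tt ¬t

pileKey : TypeSchedule → ℕ → ℕ → ℕ × ℤ
pileKey τ r i = r , signed (type τ r) i

nextPile : TypeSchedule → ℕ → ℕ → ℕ → ℕ
nextPile τ r i j = r + iverson (prec (type τ r) j i)

module _ (τ : TypeSchedule) {r i j : ℕ} where

  nextPile-blocked : signed (type τ r) j ℤ.< signed (type τ r) i → nextPile τ r i j ≡ suc r
  nextPile-blocked j≺i = trans (cong (r +_) (iverson-true (from (prec⇔signed-< (type τ r)) j≺i)))
                               (ℕP.+-comm r 1)

  nextPile-open : ¬ signed (type τ r) j ℤ.< signed (type τ r) i → nextPile τ r i j ≡ r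
  nextPile-open j⊀i = trans (cong (r +_) (iverson-false (j⊀i ∘ to (prec⇔signed-< (type τ r)))))
                            (ℕP.+-identityʳ r)

  nextPile-keyStep : i ≢ j → pileKey τ r i <lex pileKey τ (nextPile τ r i j) j
  nextPile-keyStep i≢j with signed (type τ r) j ℤP.<? signed (type τ r) i
  ... | yes j≺i rewrite nextPile-blocked j≺i = inj₁ (ℕP.n<1+n r)
  ... | no  j⊀i rewrite nextPile-open j⊀i =
    inj₂ (refl , ℤP.≤∧≢⇒< (ℤP.≮⇒≥ j⊀i) (i≢j ∘ signed-injective (type τ r)))

  nextPile-minimal : ∀ {a b} → r ≤ a → pileKey τ a i <lex pileKey τ b j → nextPile τ r i j ≤ b
  nextPile-minimal r≤a a≺b with signed (type τ r) j ℤP.<? signed (type τ r) i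
  ... | no j⊀i rewrite nextPile-open j⊀i = ℕP.≤-trans r≤a (<lex⇒proj₁-≤ a≺b)
  ... | yes j≺i rewrite nextPile-blocked j≺i with ℕP.m≤n⇒m<n∨m≡n r≤a
  ...   | inj₁ r<a = ℕP.≤-trans r<a (<lex⇒proj₁-≤ a≺b)
  ...   | inj₂ refl with a≺b
  ...     | inj₁ r<b          = r<b
  ...     | inj₂ (refl , i≺j) = contradiction i≺j (ℤP.<-asym j≺i)

pos-injective : ∀ {n} (π : Permutation′ n) {s t} → pos π s ≡ pos π t → s ≡ t
pos-injective π = Injection.injective (↔⇒↣ π) ∘ FP.toℕ-injective ∘ ℕP.suc-injective

posℕ-toℕ : ∀ {n} (π : Permutation′ n) (s : Fin n) → posℕ π (toℕ s) ≡ pos π s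
posℕ-toℕ {n} π s with toℕ s ℕ.<? n
... | yes s<n = cong (pos π) (FP.fromℕ<-toℕ s s<n)
... | no  s≮n = contradiction (FP.toℕ<n s) s≮n

module _ {m : ℕ} (τ : TypeSchedule) (π : Permutation′ (suc m)) where

  rstarℕ-positive : ∀ k → 1 ≤ rstarℕ τ π k
  rstarℕ-positive ℕ.zero    = ℕP.≤-refl
  rstarℕ-positive (ℕ.suc k) = ℕP.≤-trans (rstarℕ-positive k) (ℕP.m≤m+n _ _)

  rstar-suc : ∀ i → rstar τ π (F.suc i) ≡
    nextPile τ (rstar τ π (inject₁ i)) (pos π (inject₁ i)) (pos π (F.suc i))
  rstar-suc i = begin
    nextPile τ (rstarℕ τ π (toℕ i)) (posℕ π (toℕ i)) (posℕ π (toℕ (F.suc i)))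
      ≡⟨ cong (λ k → nextPile τ (rstarℕ τ π k) (posℕ π k) (posℕ π (toℕ (F.suc i))))
              (sym (FP.toℕ-inject₁ i)) ⟩
    nextPile τ (rstar τ π (inject₁ i)) (posℕ π (toℕ (inject₁ i))) (posℕ π (toℕ (F.suc i)))
      ≡⟨ cong₂ (nextPile τ (rstar τ π (inject₁ i))) (posℕ-toℕ π (inject₁ i)) (posℕ-toℕ π (F.suc i)) ⟩
    nextPile τ (rstar τ π (inject₁ i)) (pos π (inject₁ i)) (pos π (F.suc i)) ∎
    where open ≡-Reasoning

  rstar-sorts : Sorts τ (rstar τ π) π
  rstar-sorts = from (Sorts⇔keySteps τ (rstar τ π) π) λ i →
    subst (λ r → key τ (rstar τ π) π (inject₁ i) <lex pileKey τ r (pos π (F.suc i)))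
          (sym (rstar-suc i))
          (nextPile-keyStep τ (FP.<⇒≢ (inject₁<suc i) ∘ pos-injective π))

  rstar-minimal : ∀ {ρ} → 1 ≤ ρ zero → Sorts τ ρ π → ∀ s → rstar τ π s ≤ ρ s
  rstar-minimal {ρ} 1≤ρ₀ ρ-sorts = <-weakInduction (λ s → rstar τ π s ≤ ρ s) 1≤ρ₀ step
    where
    step : ∀ i → rstar τ π (inject₁ i) ≤ ρ (inject₁ i) → rstar τ π (F.suc i) ≤ ρ (F.suc i)
    step i ih = subst (_≤ ρ (F.suc i)) (sym (rstar-suc i))
      (nextPile-minimal τ ih (to (Sorts⇔keySteps τ ρ π) ρ-sorts i))

corollary3 : ∀ (m : ℕ) (π : Permutation′ (suc m)) (τ : TypeSchedule) →
    ∃ (λ (ρ : Fin (suc m) → ℕ) → (∀ s → IsPile τ (ρ s)) × Sorts τ ρ π) →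
    (∀ s → IsPile τ (rstar τ π s))
    × Sorts τ (rstar τ π) π
    × (∀ (ρ : Fin (suc m) → ℕ) → (∀ s → IsPile τ (ρ s)) → ρ zero ≡ 1 →
         Sorts τ ρ π → rstar τ π (fromℕ m) ≤ ρ (fromℕ m))
corollary3 m π τ (ρ , ρ-piles , ρ-sorts) = rstar-piles , rstar-sorts τ π , rstar-least
  where
  rstar-piles : ∀ s → IsPile τ (rstar τ π s)
  rstar-piles s = rstarℕ-positive τ π (toℕ s) , λ L len≡L →
    ℕP.≤-trans (rstar-minimal τ π (proj₁ (ρ-piles zero)) ρ-sorts s) (proj₂ (ρ-piles s) L len≡L)

  rstar-least : ∀ (ρ′ : Fin (suc m) → ℕ) → (∀ s → IsPile τ (ρ′ s)) → ρ′ zero ≡ 1 →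
                Sorts τ ρ′ π → rstar τ π (fromℕ m) ≤ ρ′ (fromℕ m)
  rstar-least ρ′ _ ρ′₀≡1 ρ′-sorts = rstar-minimal τ π (ℕP.≤-reflexive (sym ρ′₀≡1)) ρ′-sorts (fromℕ m)
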